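{- Let $h,k,m$ be integers with $h\ge1$, $k\ge1$, $\gcd(h,k)=1$, and $1\le m\le d=h+k$. Then $\det A_m(h,k)=(-1)^{(d-1)(m-1)}\left[\frac{k}{d}\right]$. In particular $\det K(h,k)=\left[\frac{k}{d}\right]$.
   Context: For $d=h+k$ and $m\in\{1,\dots,d\}$, $A_m(h,k)$ is the $d\times d$ permutation matrix whose entry $(i,\sigma(i))$ is $1$ (all others $0$), where $\sigma$ is the permutation of $\{1,\dots,d\}$ given, after identifying $\{1,\dots,d\}$ with $\mathbb{Z}/d\mathbb{Z}$ via $i\mapsto i\bmod d$, by $\sigma(i)\equiv ki+m-k$. $K(h,k)$ is the $(d-1)\times(d-1)$ matrix with $A_1(h,k)=\begin{pmatrix}1&0\\0&K(h,k)\end{pmatrix}$. For $\gcd(d,k)=1$, $\left[\frac{k}{d}\right]$ is the signature of the bijection $x\mapsto kx$ of $\mathbb{Z}/d\mathbb{Z}$. -}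

module Defs where

open import Data.Nat as ℕ using (ℕ; zero; suc; _∸_; _≡ᵇ_; _<ᵇ_)
open import Data.Nat.DivMod using (_%_)
open import Data.Fin using (Fin; toℕ; punchIn) renaming (zero to fzero; suc to fsuc)
open import Data.Integer as ℤ using (ℤ; -1ℤ; 0ℤ; 1ℤ)
open import Data.Bool using (Bool; true; false; if_then_else_)
open import Data.List using (List; length; filter; allFin; concatMap; map)
open import Data.Product using (_×_; _,_; proj₁; proj₂)
open import Relation.Nullary.Decidable using (Dec; yes; no)
open import Data.Fin.Properties using (_<?_)

-- square matrices over ℤ, indexed by Fin n (row, column); index i ↦ i+1 of the paper
Matrix : ℕ → Set
Matrix n = Fin n → Fin n → ℤ

neg1^ : ℕ → ℤ
neg1^ e = -1ℤ ℤ.^ e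

sumFin : (n : ℕ) → (Fin n → ℤ) → ℤ
sumFin zero    f = 0ℤ
sumFin (suc n) f = f fzero ℤ.+ sumFin n (λ j → f (fsuc j))

det : (n : ℕ) → Matrix n → ℤ
det zero    M = 1ℤ
det (suc n) M =
  sumFin (suc n) (λ j → neg1^ (toℕ j) ℤ.* (M fzero j ℤ.* det n (λ r c → M (fsuc r) (punchIn j c))))

-- x mod d, with the (irrelevant) convention x mod 0 = x
_mod_ : ℕ → ℕ → ℕ
x mod zero  = x
x mod suc d = x % suc d

-- 0-based version of σ: the paper's σ(i) ≡ k i + m - k (mod d) on {1..d} becomes
-- j ↦ (k j + m - 1) mod d on {0..d-1} (with i = j + 1, σ(i) = σ₀(j) + 1).
σ₀ : (h k m : ℕ) → ℕ → ℕ
σ₀ h k m j = (k ℕ.* j ℕ.+ m ∸ 1) mod (h ℕ.+ k)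

Aent : (h k m : ℕ) → ℕ → ℕ → ℤ
Aent h k m i j = if j ≡ᵇ σ₀ h k m i then 1ℤ else 0ℤ

A : (m h k : ℕ) → Matrix (h ℕ.+ k)
A m h k i j = Aent h k m (toℕ i) (toℕ j)

K : (h k : ℕ) → Matrix (h ℕ.+ k ∸ 1)
K h k i j = Aent h k 1 (suc (toℕ i)) (suc (toℕ j))

inversions : (n : ℕ) → (Fin n → Fin n) → ℕ
inversions n f =
  length (filter (λ p → f (proj₂ p) <? f (proj₁ p))
    (filter (λ p → proj₁ p <? proj₂ p)
      (concatMap (λ i → map (λ j → (i , j)) (allFin n)) (allFin n))))

signature : (n : ℕ) → (Fin n → Fin n) → ℤ
signature n f = neg1^ (inversions n f)

-- ℤ/dℤ identified with Fin d via residues 0..d-1; multiplication by k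
mulBy : (d k : ℕ) → Fin d → Fin d
mulBy zero    k ()
mulBy (suc d) k x = Data.Fin.fromℕ< (Data.Nat.DivMod.m%n<n (k ℕ.* toℕ x) (suc d))

legendreSym : (k d : ℕ) → ℤ
legendreSym k d = signature d (mulBy d k)

-- A_m(h,k) is the permutation matrix of the affine map x ↦ k x + (m - 1) of ℤ/dℤ, a bijection
-- because gcd(k,d) = gcd(k,h) = 1.  Expanding along the first row shows that the determinant of
-- a permutation matrix is (-1)^(number of inversions).  Raising m by one post-composes with
-- x ↦ x + 1: if p is the point sent to d - 1, the pairs through p carry d - 1 - p inversions before
-- and p inversions after, while all other pairs keep their order, so the sign is multiplied by
-- (-1)^(d-1).  Starting from m = 1, i.e. x ↦ k x, this gives det A_m = (-1)^((d-1)(m-1)) [k/d];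
-- and A_1 fixes 0, so it is block diagonal with blocks 1 and K(h,k).
module Submission where

open import Defs
open import Data.Nat using (ℕ; _+_; _*_; _∸_; _≤_)
open import Data.Nat.GCD using (gcd)
open import Data.Integer using (ℤ) renaming (_*_ to _*ℤ_)
open import Data.Product using (_×_)
open import Relation.Binary.PropositionalEquality using (_≡_)

open import Algebra.Bundles using (Monoid)
open import Data.Bool using (Bool; true; false; _∧_; if_then_else_)
open import Data.Bool.Properties using (∧-zeroʳ; ∧-identityʳ)
open import Data.Fin as Fin using (Fin; toℕ; fromℕ<; punchIn; punchOut) renaming (zero to fzero; suc to fsuc)
open import Data.Fin.Properties as FinP
  using (_<?_; _≟_; toℕ-injective; toℕ<n; toℕ≤pred[n]; toℕ-fromℕ<; punchIn-injective; punchInᵢ≢i; punchIn-punchOut)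
open import Data.Integer as ℤ using (0ℤ; 1ℤ; -1ℤ)
open import Data.Integer.Properties as ℤP using ()
open import Data.List as List using (List; []; _∷_; _++_; length; filter; tabulate; concat; allFin)
open import Data.List.Properties using (map-tabulate)
open import Data.Nat as ℕ using (zero; suc; _<_; NonZero)
open import Data.Nat.Properties as ℕP using ()
import Data.Nat.DivMod as ℕDM
open import Data.Nat.DivMod using (_%_; _/_)
open import Data.Nat.Divisibility using (_∣_; divides; >⇒∤)
open import Data.Nat.Coprimality using (Coprime; coprime-divisor; coprime-+; gcd≡1⇒coprime)
open import Data.Nat.Tactic.RingSolver using (solve-∀)
open import Data.Product using (∃; _,_; proj₁; proj₂)
open import Data.Sum using (inj₁; inj₂)
open import Data.Vec.Functional using (Vector; removeAt)
open import Function using (_∘_; _$_; id; flip)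
open import Function.Definitions using (Injective)
open import Relation.Binary.PropositionalEquality
  using (refl; sym; trans; cong; cong₂; subst; subst₂; _≢_; _≗_; module ≡-Reasoning)
open import Relation.Nullary using (Dec; does; yes; no; ¬_)
open import Relation.Nullary.Decidable using (map′; does-≡; dec-true; dec-false)
open import Relation.Nullary.Negation using (contradiction)

open import Algebra.Properties.CommutativeMonoid.Sum ℕP.+-0-commutativeMonoid
  using (sum-syntax; sum-cong-≗; sum-remove; ∑-distrib-+; sum-replicate-zero)
import Algebra.Properties.Monoid.Sum
import Algebra.Properties.Monoid.Sum ℤP.+-0-monoid as ℤΣ

does-⇔ : ∀ {a b} {P : Set a} {Q : Set b} (p? : Dec P) (q? : Dec Q) →
         (P → Q) → (Q → P) → does p? ≡ does q?
does-⇔ p? q? to from = does-≡ p? (map′ from to q?)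

𝟙 : Bool → ℕ
𝟙 true  = 1
𝟙 false = 0

𝟙ℤ : Bool → ℤ
𝟙ℤ b = if b then 1ℤ else 0ℤ

module _ {c ℓ} (M : Monoid c ℓ) where
  open Monoid M using (_≈_; ε; ∙-congˡ; ∙-congʳ; identityˡ; identityʳ)
    renaming (Carrier to C; trans to ≈-trans)
  private module Σ = Algebra.Properties.Monoid.Sum M

  sum-single : ∀ {n} (f : Vector C n) (p : Fin n) → (∀ i → i ≢ p → f i ≈ ε) → Σ.sum f ≈ f p
  sum-single {suc n} f fzero vanish = ≈-trans (∙-congˡ rest≈ε) (identityʳ (f fzero))
    where
    rest≈ε : Σ.sum (f ∘ fsuc) ≈ ε
    rest≈ε = ≈-trans (Σ.sum-cong-≋ (λ i → vanish (fsuc i) λ ())) (Σ.sum-replicate-zero n)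
  sum-single {suc n} f (fsuc p) vanish =
    ≈-trans (∙-congʳ (vanish fzero λ ())) (≈-trans (identityˡ _)
      (sum-single (f ∘ fsuc) p (λ i i≢p → vanish (fsuc i) (i≢p ∘ FinP.suc-injective))))

sum-ones : ∀ n → ∑[ i < n ] 1 ≡ n
sum-ones zero    = refl
sum-ones (suc n) = cong suc (sum-ones n)

sumFin≡sum : ∀ n (f : Fin n → ℤ) → sumFin n f ≡ ℤΣ.sum f
sumFin≡sum zero    f = refl
sumFin≡sum (suc n) f = cong (ℤ._+_ (f fzero)) (sumFin≡sum n (f ∘ fsuc))

sumFin-cong : ∀ n {f g : Fin n → ℤ} → f ≗ g → sumFin n f ≡ sumFin n g
sumFin-cong n {f} {g} f≗g = trans (sumFin≡sum n f) (trans (ℤΣ.sum-cong-≗ f≗g) (sym (sumFin≡sum n g)))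

sumFin-single : ∀ n (f : Fin n → ℤ) (p : Fin n) → (∀ i → i ≢ p → f i ≡ 0ℤ) → sumFin n f ≡ f p
sumFin-single n f p vanish = trans (sumFin≡sum n f) (sum-single ℤP.+-0-monoid f p vanish)

<?-irrefl : ∀ {n} (i : Fin n) → does (i <? i) ≡ false
<?-irrefl i = dec-false (i <? i) (ℕP.<-irrefl refl)

<?-suc : ∀ a x → 𝟙 (does (a ℕ.<? suc x)) ≡ 𝟙 (does (a ℕ.<? x)) + 𝟙 (does (a ℕ.≟ x))
<?-suc zero    zero    = refl
<?-suc zero    (suc x) = refl
<?-suc (suc a) zero    = refl
<?-suc (suc a) (suc x) = <?-suc a x

punchIn-<?-punchIn : ∀ {n} (p : Fin (suc n)) (a b : Fin n) → does (punchIn p a <? punchIn p b) ≡ does (a <? b)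
punchIn-<?-punchIn fzero    a        b        = refl
punchIn-<?-punchIn (fsuc p) fzero    fzero    = refl
punchIn-<?-punchIn (fsuc p) fzero    (fsuc b) = refl
punchIn-<?-punchIn (fsuc p) (fsuc a) fzero    = refl
punchIn-<?-punchIn (fsuc p) (fsuc a) (fsuc b) = punchIn-<?-punchIn p a b

punchIn-<?-pivot : ∀ {n} (p : Fin (suc n)) (a : Fin n) → does (punchIn p a <? p) ≡ does (a <? p)
punchIn-<?-pivot fzero    a        = refl
punchIn-<?-pivot (fsuc p) fzero    = refl
punchIn-<?-pivot (fsuc p) (fsuc a) = punchIn-<?-pivot p a

injective⇒preimage : ∀ {n} (f : Fin n → Fin n) → Injective _≡_ _≡_ f → ∀ y → ∃ λ x → f x ≡ y
injective⇒preimage {suc n} f f-inj y with FinP.any? (λ x → f x ≟ y)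
... | yes found = found
... | no ¬found = contradiction (FinP.injective⇒≤ f-y-inj) ℕP.1+n≰n
  where
  f-y : Fin (suc n) → Fin n
  f-y x = punchOut {i = y} (λ y≡fx → ¬found (x , sym y≡fx))
  f-y-inj : Injective _≡_ _≡_ f-y
  f-y-inj {a} {b} = f-inj ∘ FinP.punchOut-injective {i = y} {f a} {f b} _ _

count-< : ∀ {n} (g : Fin n → Fin n) → Injective _≡_ _≡_ g →
          ∀ {x} → x ≤ n → ∑[ j < n ] 𝟙 (does (toℕ (g j) ℕ.<? x)) ≡ x
count-< {n} g g-inj {zero}  _   = sum-replicate-zero n
count-< {n} g g-inj {suc x} x<n = begin
  ∑[ j < n ] 𝟙 (does (toℕ (g j) ℕ.<? suc x))
    ≡⟨ sum-cong-≗ (λ j → <?-suc (toℕ (g j)) x) ⟩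
  ∑[ j < n ] (𝟙 (does (toℕ (g j) ℕ.<? x)) + 𝟙 (does (toℕ (g j) ℕ.≟ x)))
    ≡⟨ ∑-distrib-+ (λ j → 𝟙 (does (toℕ (g j) ℕ.<? x))) (λ j → 𝟙 (does (toℕ (g j) ℕ.≟ x))) ⟩
  ∑[ j < n ] 𝟙 (does (toℕ (g j) ℕ.<? x)) + ∑[ j < n ] 𝟙 (does (toℕ (g j) ℕ.≟ x))
    ≡⟨ cong₂ _+_ (count-< g g-inj (ℕP.<⇒≤ x<n)) hit-once ⟩
  x + 1
    ≡⟨ ℕP.+-comm x 1 ⟩
  suc x ∎
  where
  open ≡-Reasoning
  preimage : ∃ λ j → g j ≡ fromℕ< x<n
  preimage = injective⇒preimage g g-inj (fromℕ< x<n)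
  p : Fin n
  p = proj₁ preimage
  gp≡x : toℕ (g p) ≡ x
  gp≡x = trans (cong toℕ (proj₂ preimage)) (toℕ-fromℕ< x<n)
  miss : ∀ j → j ≢ p → 𝟙 (does (toℕ (g j) ℕ.≟ x)) ≡ 0
  miss j j≢p = cong 𝟙 (dec-false (_ ℕ.≟ x) (j≢p ∘ g-inj ∘ toℕ-injective ∘ flip trans (sym gp≡x)))
  hit-once : ∑[ j < n ] 𝟙 (does (toℕ (g j) ℕ.≟ x)) ≡ 1
  hit-once = trans (sum-single ℕP.+-0-monoid _ p miss) (cong 𝟙 (dec-true (_ ℕ.≟ x) gp≡x))

count-> : ∀ {n} (p : Fin (suc n)) → ∑[ j < suc n ] 𝟙 (does (p <? j)) + toℕ p ≡ n
count-> {n}     fzero    = trans (ℕP.+-identityʳ _) (sum-ones n)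
count-> {suc n} (fsuc p) = trans (ℕP.+-suc _ (toℕ p)) (cong suc (count-> p))

inverted : ∀ {n m} → (Fin n → Fin m) → Fin n → Fin n → Bool
inverted f i j = does (i <? j) ∧ does (f j <? f i)

inversionCount : ∀ {n m} → (Fin n → Fin m) → ℕ
inversionCount {n} f = ∑[ i < n ] ∑[ j < n ] 𝟙 (inverted f i j)

inversionCount-cong : ∀ {n m m′} (f : Fin n → Fin m) (g : Fin n → Fin m′) →
                      (∀ i j → does (f i <? f j) ≡ does (g i <? g j)) → inversionCount f ≡ inversionCount g
inversionCount-cong f g same-order =
  sum-cong-≗ λ i → sum-cong-≗ λ j → cong (λ b → 𝟙 (does (i <? j) ∧ b)) (same-order j i)

inversionCount-head : ∀ {n m} (f : Fin (suc n) → Fin m) →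
  inversionCount f ≡ ∑[ j < n ] 𝟙 (does (f (fsuc j) <? f fzero)) + inversionCount (f ∘ fsuc)
inversionCount-head f = refl

inversionCount-removeAt : ∀ {n m} (f : Fin (suc n) → Fin m) (p : Fin (suc n)) →
  inversionCount f ≡ ∑[ j < suc n ] 𝟙 (inverted f p j)
                     + (∑[ i < n ] 𝟙 (inverted f (punchIn p i) p) + inversionCount (removeAt f p))
inversionCount-removeAt {n} f p = begin
  inversionCount f
    ≡⟨ sum-remove {i = p} (λ i → ∑[ j < suc n ] 𝟙 (inverted f i j)) ⟩
  row p + ∑[ i < n ] ∑[ j < suc n ] 𝟙 (inverted f (punchIn p i) j)
    ≡⟨ cong (row p +_) (sum-cong-≗ λ i → sum-remove {i = p} (λ j → 𝟙 (inverted f (punchIn p i) j))) ⟩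
  row p + ∑[ i < n ] (column i + ∑[ j < n ] 𝟙 (inverted f (punchIn p i) (punchIn p j)))
    ≡⟨ cong (row p +_) (∑-distrib-+ column λ i → ∑[ j < n ] 𝟙 (inverted f (punchIn p i) (punchIn p j))) ⟩
  row p + (∑[ i < n ] column i + ∑[ i < n ] ∑[ j < n ] 𝟙 (inverted f (punchIn p i) (punchIn p j)))
    ≡⟨ cong (λ z → row p + (∑[ i < n ] column i + z)) (sum-cong-≗ λ i → sum-cong-≗ λ j →
         cong (λ b → 𝟙 (b ∧ does (f (punchIn p j) <? f (punchIn p i)))) (punchIn-<?-punchIn p i j)) ⟩
  row p + (∑[ i < n ] column i + inversionCount (removeAt f p)) ∎
  where
  open ≡-Reasoning
  row : Fin (suc n) → ℕ
  row i = ∑[ j < suc n ] 𝟙 (inverted f i j)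
  column : Fin n → ℕ
  column i = 𝟙 (inverted f (punchIn p i) p)

countᴸ : ∀ {a} {A : Set a} → (A → Bool) → List A → ℕ
countᴸ b []       = 0
countᴸ b (x ∷ xs) = 𝟙 (b x) + countᴸ b xs

length-filter-filter : ∀ {a p q} {A : Set a} {P : A → Set p} {Q : A → Set q}
  (P? : ∀ x → Dec (P x)) (Q? : ∀ x → Dec (Q x)) (xs : List A) →
  length (filter P? (filter Q? xs)) ≡ countᴸ (λ x → does (Q? x) ∧ does (P? x)) xs
length-filter-filter P? Q? []       = refl
length-filter-filter P? Q? (x ∷ xs) with does (Q? x) | length-filter-filter P? Q? xs
... | false | ih = ih
... | true  | ih with does (P? x)
...   | false = ih
...   | true  = cong suc ih

countᴸ-++ : ∀ {a} {A : Set a} (b : A → Bool) xs ys → countᴸ b (xs ++ ys) ≡ countᴸ b xs + countᴸ b ys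
countᴸ-++ b []       ys = refl
countᴸ-++ b (x ∷ xs) ys = trans (cong (𝟙 (b x) +_) (countᴸ-++ b xs ys)) (sym (ℕP.+-assoc (𝟙 (b x)) _ _))

countᴸ-tabulate : ∀ {a} {A : Set a} (b : A → Bool) {n} (f : Fin n → A) →
                  countᴸ b (tabulate f) ≡ ∑[ i < n ] 𝟙 (b (f i))
countᴸ-tabulate b {zero}  f = refl
countᴸ-tabulate b {suc n} f = cong (𝟙 (b (f fzero)) +_) (countᴸ-tabulate b (f ∘ fsuc))

countᴸ-concat-tabulate : ∀ {a} {A : Set a} (b : A → Bool) {n} (f : Fin n → List A) →
                         countᴸ b (concat (tabulate f)) ≡ ∑[ i < n ] countᴸ b (f i)
countᴸ-concat-tabulate b {zero}  f = refl
countᴸ-concat-tabulate b {suc n} f =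
  trans (countᴸ-++ b (f fzero) _) (cong (countᴸ b (f fzero) +_) (countᴸ-concat-tabulate b (f ∘ fsuc)))

inversions≡inversionCount : ∀ n (f : Fin n → Fin n) → inversions n f ≡ inversionCount f
inversions≡inversionCount n f = begin
  inversions n f
    ≡⟨ length-filter-filter _ _ (List.concatMap row (allFin n)) ⟩
  countᴸ inverted′ (concat (List.map row (allFin n)))
    ≡⟨ cong (countᴸ inverted′ ∘ concat) (map-tabulate id row) ⟩
  countᴸ inverted′ (concat (tabulate row))
    ≡⟨ countᴸ-concat-tabulate inverted′ row ⟩
  ∑[ i < n ] countᴸ inverted′ (row i)
    ≡⟨ sum-cong-≗ (λ i → trans (cong (countᴸ inverted′) (map-tabulate id (i ,_)))
                               (countᴸ-tabulate inverted′ (i ,_))) ⟩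
  inversionCount f ∎
  where
  open ≡-Reasoning
  row : Fin n → List (Fin n × Fin n)
  row i = List.map (i ,_) (allFin n)
  inverted′ : Fin n × Fin n → Bool
  inverted′ (i , j) = inverted f i j

neg1^-even : ∀ c → neg1^ (2 * c) ≡ 1ℤ
neg1^-even c = trans (sym (ℤP.^-*-assoc -1ℤ 2 c)) (ℤP.^-zeroˡ c)

neg1^-parity : ∀ a b c e → a + 2 * c ≡ b + 2 * e → neg1^ a ≡ neg1^ b
neg1^-parity a b c e a+2c≡b+2e = begin
  neg1^ a                     ≡⟨ ℤP.*-identityʳ (neg1^ a) ⟨
  neg1^ a *ℤ 1ℤ               ≡⟨ cong (neg1^ a *ℤ_) (neg1^-even c) ⟨
  neg1^ a *ℤ neg1^ (2 * c)    ≡⟨ ℤP.^-distribˡ-+-* -1ℤ a (2 * c) ⟨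
  neg1^ (a + 2 * c)           ≡⟨ cong neg1^ a+2c≡b+2e ⟩
  neg1^ (b + 2 * e)           ≡⟨ ℤP.^-distribˡ-+-* -1ℤ b (2 * e) ⟩
  neg1^ b *ℤ neg1^ (2 * e)    ≡⟨ cong (neg1^ b *ℤ_) (neg1^-even e) ⟩
  neg1^ b *ℤ 1ℤ               ≡⟨ ℤP.*-identityʳ (neg1^ b) ⟩
  neg1^ b                     ∎
  where open ≡-Reasoning

module _ {n} (f g : Fin (suc n) → Fin (suc n)) (f-inj : Injective _≡_ _≡_ f)
         (g≡1+f : ∀ i → toℕ (g i) ≡ suc (toℕ (f i)) % suc n) where

  module _ (p : Fin (suc n)) (fp≡n : toℕ (f p) ≡ n) where

    private
      f-below : ∀ i → i ≢ p → toℕ (f i) < n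
      f-below i i≢p = ℕP.≤∧≢⇒< (toℕ≤pred[n] (f i)) (i≢p ∘ f-inj ∘ toℕ-injective ∘ flip trans (sym fp≡n))

      g-pivot : toℕ (g p) ≡ 0
      g-pivot = trans (g≡1+f p) (trans (cong (λ x → suc x % suc n) fp≡n) (ℕDM.n%n≡0 (suc n)))

      g-off-pivot : ∀ i → i ≢ p → toℕ (g i) ≡ suc (toℕ (f i))
      g-off-pivot i i≢p = trans (g≡1+f i) (ℕDM.m<n⇒m%n≡m (ℕ.s≤s (f-below i i≢p)))

      f-row : ∀ j → inverted f p j ≡ does (p <? j)
      f-row j with j ≟ p
      ... | yes refl = trans (cong (_∧ does (f p <? f p)) (<?-irrefl p)) (sym (<?-irrefl p))
      ... | no  j≢p  = trans (cong (does (p <? j) ∧_) (dec-true (f j <? f p) fj<fp)) (∧-identityʳ _)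
        where
        fj<fp : toℕ (f j) < toℕ (f p)
        fj<fp = subst (toℕ (f j) <_) (sym fp≡n) (f-below j j≢p)

      f-column : ∀ i → inverted f (punchIn p i) p ≡ false
      f-column i =
        trans (cong (does (punchIn p i <? p) ∧_) (dec-false (f p <? f (punchIn p i)) fp≮fi)) (∧-zeroʳ _)
        where
        fp≮fi : ¬ toℕ (f p) < toℕ (f (punchIn p i))
        fp≮fi = ℕP.≤⇒≯ (subst (toℕ (f (punchIn p i)) ≤_) (sym fp≡n) (toℕ≤pred[n] (f (punchIn p i))))

      g-row : ∀ j → inverted g p j ≡ false
      g-row j = trans (cong (does (p <? j) ∧_) (dec-false (g j <? g p) gj≮gp)) (∧-zeroʳ _)
        where
        gj≮gp : ¬ toℕ (g j) < toℕ (g p)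
        gj≮gp = ℕP.n≮0 ∘ subst (toℕ (g j) <_) g-pivot

      g-column : ∀ i → inverted g (punchIn p i) p ≡ does (i <? p)
      g-column i = trans (cong (does (punchIn p i <? p) ∧_) (dec-true (g p <? g (punchIn p i)) gp<gi))
                         (trans (∧-identityʳ _) (punchIn-<?-pivot p i))
        where
        gp<gi : toℕ (g p) < toℕ (g (punchIn p i))
        gp<gi = subst₂ _<_ (sym g-pivot) (sym (g-off-pivot _ (punchInᵢ≢i p i))) (ℕ.s≤s ℕ.z≤n)

      same-order : ∀ i j → does (g (punchIn p i) <? g (punchIn p j)) ≡ does (f (punchIn p i) <? f (punchIn p j))
      same-order i j =
        cong₂ (λ a b → does (a ℕ.<? b)) (g-off-pivot _ (punchInᵢ≢i p i)) (g-off-pivot _ (punchInᵢ≢i p j))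

    inversionCount-pivot-max :
      inversionCount f ≡ ∑[ j < suc n ] 𝟙 (does (p <? j)) + inversionCount (removeAt f p)
    inversionCount-pivot-max = trans (inversionCount-removeAt f p)
      (cong₂ _+_ (sum-cong-≗ (cong 𝟙 ∘ f-row))
                 (cong (_+ inversionCount (removeAt f p))
                       (trans (sum-cong-≗ (cong 𝟙 ∘ f-column)) (sum-replicate-zero n))))

    inversionCount-pivot-min : inversionCount g ≡ toℕ p + inversionCount (removeAt f p)
    inversionCount-pivot-min = trans (inversionCount-removeAt g p)
      (cong₂ _+_ (trans (sum-cong-≗ (cong 𝟙 ∘ g-row)) (sum-replicate-zero (suc n)))
                 (cong₂ _+_ (trans (sum-cong-≗ (cong 𝟙 ∘ g-column)) (count-< id id (toℕ≤pred[n] p)))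
                            (inversionCount-cong (removeAt g p) (removeAt f p) same-order)))

    inversionCount-rotate : inversionCount g + n ≡ inversionCount f + 2 * toℕ p
    inversionCount-rotate = begin
      inversionCount g + n                      ≡⟨ cong₂ _+_ inversionCount-pivot-min (sym (count-> p)) ⟩
      (toℕ p + rest) + (above + toℕ p)          ≡⟨ regroup (toℕ p) rest above ⟩
      (above + rest) + 2 * toℕ p                ≡⟨ cong (_+ 2 * toℕ p) inversionCount-pivot-max ⟨
      inversionCount f + 2 * toℕ p              ∎
      where
      open ≡-Reasoning
      rest above : ℕ
      rest  = inversionCount (removeAt f p)
      above = ∑[ j < suc n ] 𝟙 (does (p <? j))
      regroup : ∀ a b c → (a + b) + (c + a) ≡ (c + b) + 2 * a
      regroup = solve-∀

  sign-rotate : neg1^ (inversionCount g) ≡ neg1^ n *ℤ neg1^ (inversionCount f)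
  sign-rotate = begin
    neg1^ (inversionCount g)
      ≡⟨ neg1^-parity (inversionCount g) (n + inversionCount f) n (toℕ p) parity ⟩
    neg1^ (n + inversionCount f)
      ≡⟨ ℤP.^-distribˡ-+-* -1ℤ n (inversionCount f) ⟩
    neg1^ n *ℤ neg1^ (inversionCount f) ∎
    where
    open ≡-Reasoning
    preimage : ∃ λ i → f i ≡ Fin.fromℕ n
    preimage = injective⇒preimage f f-inj (Fin.fromℕ n)
    p : Fin (suc n)
    p = proj₁ preimage
    parity : inversionCount g + 2 * n ≡ (n + inversionCount f) + 2 * toℕ p
    parity = begin
      inversionCount g + 2 * n            ≡⟨ split (inversionCount g) n ⟩
      (inversionCount g + n) + n          ≡⟨ cong (_+ n) (inversionCount-rotate p fp≡n) ⟩
      (inversionCount f + 2 * toℕ p) + n  ≡⟨ swap (inversionCount f) (toℕ p) n ⟩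
      (n + inversionCount f) + 2 * toℕ p  ∎
      where
      fp≡n : toℕ (f p) ≡ n
      fp≡n = trans (cong toℕ (proj₂ preimage)) (FinP.toℕ-fromℕ n)
      split : ∀ a b → a + 2 * b ≡ (a + b) + b
      split = solve-∀
      swap : ∀ a b c → (a + 2 * b) + c ≡ (c + a) + 2 * b
      swap = solve-∀

det-cong : ∀ n {M N : Matrix n} → (∀ i j → M i j ≡ N i j) → det n M ≡ det n N
det-cong zero    M≡N = refl
det-cong (suc n) M≡N = sumFin-cong (suc n) λ j →
  cong (neg1^ (toℕ j) *ℤ_) (cong₂ _*ℤ_ (M≡N fzero j) (det-cong n λ r c → M≡N (fsuc r) (punchIn j c)))

det-expand-single : ∀ n (M : Matrix (suc n)) (p : Fin (suc n)) → (∀ j → j ≢ p → M fzero j ≡ 0ℤ) →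
                    det (suc n) M ≡ neg1^ (toℕ p) *ℤ (M fzero p *ℤ det n (λ r c → M (fsuc r) (punchIn p c)))
det-expand-single n M p vanish = sumFin-single (suc n) _ p λ j j≢p →
  trans (cong (λ x → neg1^ (toℕ j) *ℤ (x *ℤ det n (λ r c → M (fsuc r) (punchIn j c)))) (vanish j j≢p))
        (ℤP.*-zeroʳ (neg1^ (toℕ j)))

det-blockDiag-1 : ∀ n (M : Matrix (suc n)) → M fzero fzero ≡ 1ℤ →
                  (∀ j → j ≢ fzero → M fzero j ≡ 0ℤ) →
                  det (suc n) M ≡ det n (λ r c → M (fsuc r) (fsuc c))
det-blockDiag-1 n M corner vanish = begin
  det (suc n) M                        ≡⟨ det-expand-single n M fzero vanish ⟩
  1ℤ *ℤ (M fzero fzero *ℤ minor)       ≡⟨ ℤP.*-identityˡ _ ⟩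
  M fzero fzero *ℤ minor               ≡⟨ cong (_*ℤ minor) corner ⟩
  1ℤ *ℤ minor                          ≡⟨ ℤP.*-identityˡ minor ⟩
  minor                                ∎
  where
  open ≡-Reasoning
  minor : ℤ
  minor = det n (λ r c → M (fsuc r) (fsuc c))

permutationMatrix : ∀ {n} → (Fin n → Fin n) → Matrix n
permutationMatrix f i j = 𝟙ℤ (does (j ≟ f i))

module _ {n} (f : Fin (suc n) → Fin (suc n)) (f-inj : Injective _≡_ _≡_ f) where

  private
    head≢tail : ∀ r → f fzero ≢ f (fsuc r)
    head≢tail r = (λ ()) ∘ f-inj

  dropHead : Fin n → Fin n
  dropHead r = punchOut (head≢tail r)

  tail≡punchIn-dropHead : ∀ r → f (fsuc r) ≡ punchIn (f fzero) (dropHead r)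
  tail≡punchIn-dropHead r = sym (punchIn-punchOut (head≢tail r))

  dropHead-injective : Injective _≡_ _≡_ dropHead
  dropHead-injective {r} {s} = FinP.suc-injective ∘ f-inj ∘ FinP.punchOut-injective (head≢tail r) (head≢tail s)

  minor-permutationMatrix : ∀ r c →
    permutationMatrix f (fsuc r) (punchIn (f fzero) c) ≡ permutationMatrix dropHead r c
  minor-permutationMatrix r c = cong 𝟙ℤ (does-⇔ (punchIn (f fzero) c ≟ f (fsuc r)) (c ≟ dropHead r)
    (λ e → punchIn-injective (f fzero) c (dropHead r) (trans e (tail≡punchIn-dropHead r)))
    (λ e → trans (cong (punchIn (f fzero)) e) (sym (tail≡punchIn-dropHead r))))

  inversionCount-dropHead : inversionCount f ≡ toℕ (f fzero) + inversionCount dropHead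
  inversionCount-dropHead = trans (inversionCount-head f) (cong₂ _+_ head-inversions tail-inversions)
    where
    head-inversions : ∑[ j < n ] 𝟙 (does (f (fsuc j) <? f fzero)) ≡ toℕ (f fzero)
    head-inversions = trans
      (sum-cong-≗ λ j → cong 𝟙 (trans (cong (λ x → does (x <? f fzero)) (tail≡punchIn-dropHead j))
                                      (punchIn-<?-pivot (f fzero) (dropHead j))))
      (count-< dropHead dropHead-injective (toℕ≤pred[n] (f fzero)))
    tail-inversions : inversionCount (f ∘ fsuc) ≡ inversionCount dropHead
    tail-inversions = inversionCount-cong (f ∘ fsuc) dropHead λ i j →
      trans (cong₂ (λ a b → does (a <? b)) (tail≡punchIn-dropHead i) (tail≡punchIn-dropHead j))
            (punchIn-<?-punchIn (f fzero) (dropHead i) (dropHead j))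

det-permutationMatrix : ∀ n (f : Fin n → Fin n) → Injective _≡_ _≡_ f →
                        det n (permutationMatrix f) ≡ neg1^ (inversionCount f)
det-permutationMatrix zero    f f-inj = refl
det-permutationMatrix (suc n) f f-inj = begin
  det (suc n) (permutationMatrix f)
    ≡⟨ det-expand-single n (permutationMatrix f) p off-p ⟩
  neg1^ (toℕ p) *ℤ (𝟙ℤ (does (p ≟ p)) *ℤ minor)
    ≡⟨ cong (λ b → neg1^ (toℕ p) *ℤ (𝟙ℤ b *ℤ minor)) (dec-true (p ≟ p) refl) ⟩
  neg1^ (toℕ p) *ℤ (1ℤ *ℤ minor)
    ≡⟨ cong (neg1^ (toℕ p) *ℤ_) (trans (ℤP.*-identityˡ minor) (det-cong n (minor-permutationMatrix f f-inj))) ⟩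
  neg1^ (toℕ p) *ℤ det n (permutationMatrix f′)
    ≡⟨ cong (neg1^ (toℕ p) *ℤ_) (det-permutationMatrix n f′ (dropHead-injective f f-inj)) ⟩
  neg1^ (toℕ p) *ℤ neg1^ (inversionCount f′)
    ≡⟨ ℤP.^-distribˡ-+-* -1ℤ (toℕ p) (inversionCount f′) ⟨
  neg1^ (toℕ p + inversionCount f′)
    ≡⟨ cong neg1^ (inversionCount-dropHead f f-inj) ⟨
  neg1^ (inversionCount f) ∎
  where
  open ≡-Reasoning
  p : Fin (suc n)
  p = f fzero
  f′ : Fin n → Fin n
  f′ = dropHead f f-inj
  minor : ℤ
  minor = det n (λ r c → permutationMatrix f (fsuc r) (punchIn p c))
  off-p : ∀ j → j ≢ p → permutationMatrix f fzero j ≡ 0ℤ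
  off-p j j≢p = cong 𝟙ℤ (dec-false (j ≟ p) j≢p)

suc-% : ∀ x d .{{_ : NonZero d}} → suc x % d ≡ suc (x % d) % d
suc-% x d = trans (cong (λ y → suc y % d) (ℕDM.m≡m%n+[m/n]*n x d)) (ℕDM.[m+kn]%n≡m%n (suc (x % d)) (x / d) d)

%≡%⇒∣∸ : ∀ m n d .{{_ : NonZero d}} → m % d ≡ n % d → d ∣ n ∸ m
%≡%⇒∣∸ m n d m%d≡n%d = divides (n / d ∸ m / d) $ begin
  n ∸ m
    ≡⟨ cong₂ _∸_ (ℕDM.m≡m%n+[m/n]*n n d) (ℕDM.m≡m%n+[m/n]*n m d) ⟩
  (n % d + n / d * d) ∸ (m % d + m / d * d)
    ≡⟨ cong (λ r → (n % d + n / d * d) ∸ (r + m / d * d)) m%d≡n%d ⟩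
  (n % d + n / d * d) ∸ (n % d + m / d * d)
    ≡⟨ ℕP.[m+n]∸[m+o]≡n∸o (n % d) (n / d * d) (m / d * d) ⟩
  n / d * d ∸ m / d * d
    ≡⟨ ℕP.*-distribʳ-∸ d (n / d) (m / d) ⟨
  (n / d ∸ m / d) * d ∎
  where open ≡-Reasoning

∣∧<⇒≡0 : ∀ {d x} → d ∣ x → x < d → x ≡ 0
∣∧<⇒≡0 {x = zero}  _   _   = refl
∣∧<⇒≡0 {x = suc x} d∣x x<d = contradiction d∣x (>⇒∤ x<d)

affine-%-cancel : ∀ {d k a b} t .{{_ : NonZero d}} → Coprime d k → a ≤ b → b < d →
                  (t + k * a) % d ≡ (t + k * b) % d → a ≡ b
affine-%-cancel {d} {k} {a} {b} t d⊥k a≤b b<d same = ℕP.≤-antisym a≤b (ℕP.m∸n≡0⇒m≤n b∸a≡0)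
  where
  difference : (t + k * b) ∸ (t + k * a) ≡ k * (b ∸ a)
  difference = trans (ℕP.[m+n]∸[m+o]≡n∸o t (k * b) (k * a)) (sym (ℕP.*-distribˡ-∸ k b a))
  b∸a≡0 : b ∸ a ≡ 0
  b∸a≡0 = ∣∧<⇒≡0 (coprime-divisor d⊥k (subst (d ∣_) difference (%≡%⇒∣∸ _ _ d same)))
                 (ℕP.≤-<-trans (ℕP.m∸n≤m b a) b<d)

affine-%-injective : ∀ {d k a b} t .{{_ : NonZero d}} → Coprime d k → a < d → b < d →
                     (t + k * a) % d ≡ (t + k * b) % d → a ≡ b
affine-%-injective {a = a} {b} t d⊥k a<d b<d same with ℕP.≤-total a b
... | inj₁ a≤b = affine-%-cancel t d⊥k a≤b b<d same
... | inj₂ b≤a = sym (affine-%-cancel t d⊥k b≤a a<d (sym same))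

module AffinePermutation (h′ k : ℕ) (d⊥k : Coprime (suc h′ + k) k) where

  n d : ℕ
  n = h′ + k
  d = suc n

  -- affine t is the paper's σ for m = t + 1 (shifted to 0-based indices); putting t first makes
  -- affine 0 definitionally equal to mulBy d k.
  affine : ℕ → Fin d → Fin d
  affine t x = fromℕ< (ℕDM.m%n<n (t + k * toℕ x) d)

  toℕ-affine : ∀ t x → toℕ (affine t x) ≡ (t + k * toℕ x) % d
  toℕ-affine t x = toℕ-fromℕ< _

  affine-injective : ∀ t → Injective _≡_ _≡_ (affine t)
  affine-injective t {x} {y} eq = toℕ-injective (affine-%-injective t d⊥k (toℕ<n x) (toℕ<n y) (begin
    (t + k * toℕ x) % d  ≡⟨ toℕ-affine t x ⟨
    toℕ (affine t x)     ≡⟨ cong toℕ eq ⟩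
    toℕ (affine t y)     ≡⟨ toℕ-affine t y ⟩
    (t + k * toℕ y) % d  ∎))
    where open ≡-Reasoning

  affine-suc : ∀ t x → toℕ (affine (suc t) x) ≡ suc (toℕ (affine t x)) % d
  affine-suc t x = trans (toℕ-affine (suc t) x)
    (trans (suc-% (t + k * toℕ x) d) (cong (λ y → suc y % d) (sym (toℕ-affine t x))))

  sign₀ : ℤ
  sign₀ = neg1^ (inversionCount (affine 0))

  sign-affine : ∀ t → neg1^ (inversionCount (affine t)) ≡ neg1^ (n * t) *ℤ sign₀
  sign-affine zero    = sym (trans (cong (λ e → neg1^ e *ℤ sign₀) (ℕP.*-zeroʳ n)) (ℤP.*-identityˡ sign₀))
  sign-affine (suc t) = begin
    neg1^ (inversionCount (affine (suc t)))
      ≡⟨ sign-rotate (affine t) (affine (suc t)) (affine-injective t) (affine-suc t) ⟩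
    neg1^ n *ℤ neg1^ (inversionCount (affine t))
      ≡⟨ cong (neg1^ n *ℤ_) (sign-affine t) ⟩
    neg1^ n *ℤ (neg1^ (n * t) *ℤ sign₀)   ≡⟨ ℤP.*-assoc (neg1^ n) (neg1^ (n * t)) sign₀ ⟨
    (neg1^ n *ℤ neg1^ (n * t)) *ℤ sign₀   ≡⟨ cong (_*ℤ sign₀) (ℤP.^-distribˡ-+-* -1ℤ n (n * t)) ⟨
    neg1^ (n + n * t) *ℤ sign₀            ≡⟨ cong (λ e → neg1^ e *ℤ sign₀) (ℕP.*-suc n t) ⟨
    neg1^ (n * suc t) *ℤ sign₀            ∎
    where open ≡-Reasoning

  legendreSym≡sign₀ : legendreSym k d ≡ sign₀
  legendreSym≡sign₀ = cong neg1^ (inversions≡inversionCount d (affine 0))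

  A≡permutationMatrix : ∀ t i j → A (suc t) (suc h′) k i j ≡ permutationMatrix (affine t) i j
  A≡permutationMatrix t i j = cong 𝟙ℤ
    (does-⇔ (toℕ j ℕ.≟ σ₀ (suc h′) k (suc t) (toℕ i)) (j ≟ affine t i)
      (λ e → toℕ-injective (trans e σ₀≡affine)) (λ e → trans (cong toℕ e) (sym σ₀≡affine)))
    where
    σ₀≡affine : σ₀ (suc h′) k (suc t) (toℕ i) ≡ toℕ (affine t i)
    σ₀≡affine = begin
      (k * toℕ i + suc t ∸ 1) % d  ≡⟨ cong (λ y → (y ∸ 1) % d) (ℕP.+-suc (k * toℕ i) t) ⟩
      (k * toℕ i + t) % d          ≡⟨ cong (_% d) (ℕP.+-comm (k * toℕ i) t) ⟩
      (t + k * toℕ i) % d          ≡⟨ toℕ-affine t i ⟨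
      toℕ (affine t i)             ∎
      where open ≡-Reasoning

  det-A : ∀ t → det d (A (suc t) (suc h′) k) ≡ neg1^ (n * t) *ℤ legendreSym k d
  det-A t = begin
    det d (A (suc t) (suc h′) k)          ≡⟨ det-cong d (A≡permutationMatrix t) ⟩
    det d (permutationMatrix (affine t))  ≡⟨ det-permutationMatrix d (affine t) (affine-injective t) ⟩
    neg1^ (inversionCount (affine t))     ≡⟨ sign-affine t ⟩
    neg1^ (n * t) *ℤ sign₀                ≡⟨ cong (neg1^ (n * t) *ℤ_) legendreSym≡sign₀ ⟨
    neg1^ (n * t) *ℤ legendreSym k d      ∎
    where open ≡-Reasoning

  det-K : det n (K (suc h′) k) ≡ legendreSym k d
  det-K = begin
    det n (K (suc h′) k)                ≡⟨ det-blockDiag-1 n (A 1 (suc h′) k) corner off-corner ⟨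
    det d (A 1 (suc h′) k)              ≡⟨ det-A 0 ⟩
    neg1^ (n * 0) *ℤ legendreSym k d    ≡⟨ cong (λ e → neg1^ e *ℤ legendreSym k d) (ℕP.*-zeroʳ n) ⟩
    1ℤ *ℤ legendreSym k d               ≡⟨ ℤP.*-identityˡ _ ⟩
    legendreSym k d                     ∎
    where
    open ≡-Reasoning
    affine0-fixes-0 : affine 0 fzero ≡ fzero
    affine0-fixes-0 = toℕ-injective (trans (toℕ-affine 0 fzero) (cong (_% d) (ℕP.*-zeroʳ k)))
    corner : A 1 (suc h′) k fzero fzero ≡ 1ℤ
    corner = trans (A≡permutationMatrix 0 fzero fzero)
                   (cong 𝟙ℤ (dec-true (fzero ≟ affine 0 fzero) (sym affine0-fixes-0)))
    off-corner : ∀ j → j ≢ fzero → A 1 (suc h′) k fzero j ≡ 0ℤ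
    off-corner j j≢0 = trans (A≡permutationMatrix 0 fzero j)
                             (cong 𝟙ℤ (dec-false (j ≟ affine 0 fzero) (j≢0 ∘ flip trans affine0-fixes-0)))

proposition3 : (h k m : ℕ) → 1 ≤ h → 1 ≤ k → gcd h k ≡ 1 → 1 ≤ m → m ≤ h + k →
    (det (h + k) (A m h k) ≡ neg1^ ((h + k ∸ 1) * (m ∸ 1)) *ℤ legendreSym k (h + k))
    × (det (h + k ∸ 1) (K h k) ≡ legendreSym k (h + k))
proposition3 (suc h′) k (suc t) _ _ gcd≡1 _ _ = det-A t , det-K
  where
  d⊥k : Coprime (suc h′ + k) k
  d⊥k = subst (λ d → Coprime d k) (ℕP.+-comm k (suc h′)) (coprime-+ (gcd≡1⇒coprime gcd≡1))
  open AffinePermutation h′ k d⊥k
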